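{- There are no integers, and no rational numbers, $x_1,x_2,x_3,d_1,d_2,d_3,L$ with $\operatorname{rank}N_1=2$ and $\operatorname{rank}N_2=1$ that satisfy the seven factor equations $\tilde p_2=\tilde p_3=\tilde p_4=\tilde p_5=\tilde p_6=\tilde p_7=\tilde p_8=0$; likewise there are none with $\operatorname{rank}N_1=2$ and $\operatorname{rank}N_2=1$ satisfying the equations $p_1=p_2=p_3=0$.
   Context: Define $p_1=x_2^2+x_3^2-d_1^2$, $p_2=x_3^2+x_1^2-d_2^2$, $p_3=x_1^2+x_2^2-d_3^2$, and $\tilde p_2=p_1+p_2+p_3$, $\tilde p_3=\sum_i d_ip_i$, $\tilde p_4=\sum_i x_ip_i$, $\tilde p_5=\sum_i x_id_ip_i$, $\tilde p_6=\sum_i x_i^2p_i$, $\tilde p_7=\sum_i d_i^2p_i$, $\tilde p_8=\sum_i x_i^2d_i^2p_i$ (sums over $i=1,2,3$). $N_1$ is the $3\times2$ matrix with rows $(1,d_i)$, $i=1,2,3$, and $N_2$ is the $3\times 2$ matrix with rows $(1,x_i)$, $i=1,2,3$. -}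

module Defs where

open import Level using (Level)
open import Data.Nat using (ℕ)
open import Data.Bool using (Bool; true; false; if_then_else_; _∨_; not)
open import Data.Fin using (Fin; zero; suc)
open import Data.Product using (_×_; Σ; ∃; _,_)
open import Relation.Nullary using (¬_; does)
open import Relation.Binary using (Decidable)
open import Relation.Binary.PropositionalEquality using (_≡_)
open import Algebra.Bundles using (CommutativeRing)
import Data.Integer as ℤ
import Data.Integer.Properties as ℤP
import Data.Rational as ℚ
import Data.Rational.Properties as ℚP

module Generic {c ℓ : Level} (R : CommutativeRing c ℓ)
               (_≟_ : Decidable (CommutativeRing._≈_ R)) where
  open CommutativeRing R using (Carrier; _≈_; _+_; _*_; _-_; 0#; 1#)

  Mat₃ₓ₂ : Set c
  Mat₃ₓ₂ = Fin 3 → Fin 2 → Carrier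

  nz : Carrier → Bool
  nz a = not (does (a ≟ 0#))

  minor : Mat₃ₓ₂ → Fin 3 → Fin 3 → Carrier
  minor M i j = M i zero * M j (suc zero) - M j zero * M i (suc zero)

  i0 i1 i2 : Fin 3
  i0 = zero
  i1 = suc zero
  i2 = suc (suc zero)

  someMinorNZ : Mat₃ₓ₂ → Bool
  someMinorNZ M = nz (minor M i0 i1) ∨ nz (minor M i0 i2) ∨ nz (minor M i1 i2)

  someEntryNZ : Mat₃ₓ₂ → Bool
  someEntryNZ M = (nz (M i0 zero) ∨ nz (M i0 (suc zero)))
                ∨ (nz (M i1 zero) ∨ nz (M i1 (suc zero)))
                ∨ (nz (M i2 zero) ∨ nz (M i2 (suc zero)))

  rank : Mat₃ₓ₂ → ℕ
  rank M = if someMinorNZ M then 2 else (if someEntryNZ M then 1 else 0)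

  N₁ : (Fin 3 → Carrier) → Mat₃ₓ₂
  N₁ d i zero = 1#
  N₁ d i (suc _) = d i

  N₂ : (Fin 3 → Carrier) → Mat₃ₓ₂
  N₂ x i zero = 1#
  N₂ x i (suc _) = x i

  sq : Carrier → Carrier
  sq a = a * a

  p : (x d : Fin 3 → Carrier) → Fin 3 → Carrier
  p x d zero             = sq (x i1) + sq (x i2) - sq (d i0)
  p x d (suc zero)       = sq (x i2) + sq (x i0) - sq (d i1)
  p x d (suc (suc zero)) = sq (x i0) + sq (x i1) - sq (d i2)

  Σ₃ : (Fin 3 → Carrier) → Carrier
  Σ₃ f = f i0 + f i1 + f i2

  p̃₂ p̃₃ p̃₄ p̃₅ p̃₆ p̃₇ p̃₈ : (x d : Fin 3 → Carrier) → Carrier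
  p̃₂ x d = Σ₃ (λ i → p x d i)
  p̃₃ x d = Σ₃ (λ i → d i * p x d i)
  p̃₄ x d = Σ₃ (λ i → x i * p x d i)
  p̃₅ x d = Σ₃ (λ i → x i * d i * p x d i)
  p̃₆ x d = Σ₃ (λ i → sq (x i) * p x d i)
  p̃₇ x d = Σ₃ (λ i → sq (d i) * p x d i)
  p̃₈ x d = Σ₃ (λ i → sq (x i) * sq (d i) * p x d i)

  FactorEqs : (x d : Fin 3 → Carrier) → Set ℓ
  FactorEqs x d = (p̃₂ x d ≈ 0#) × (p̃₃ x d ≈ 0#) × (p̃₄ x d ≈ 0#) × (p̃₅ x d ≈ 0#)
                × (p̃₆ x d ≈ 0#) × (p̃₇ x d ≈ 0#) × (p̃₈ x d ≈ 0#)

  PEqs : (x d : Fin 3 → Carrier) → Set ℓ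
  PEqs x d = (p x d i0 ≈ 0#) × (p x d i1 ≈ 0#) × (p x d i2 ≈ 0#)

  -- no x, d, L with rank N₁ = 2, rank N₂ = 1 satisfying the given equations
  -- (L is a further unknown that does not occur in the equations)
  NoSolution : ((x d : Fin 3 → Carrier) → Set ℓ) → Set (c Level.⊔ ℓ)
  NoSolution Eqs = ¬ (Σ (Fin 3 → Carrier) λ x → Σ (Fin 3 → Carrier) λ d →
                      Σ Carrier λ L →
                      (rank (N₁ d) ≡ 2) × (rank (N₂ x) ≡ 1) × Eqs x d)

module Zc = Generic ℤP.+-*-commutativeRing ℤ._≟_
module Qc = Generic ℚP.+-*-commutativeRing ℚ._≟_

module Submission where

open import Defs
open import Data.Product using (_×_; _,_; ∃-syntax)
open import Level using (Level; _⊔_)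
open import Data.Bool using (true; false; if_then_else_; _∨_)
open import Data.Empty using (⊥; ⊥-elim)
open import Data.Sum using ([_,_]′)
open import Function using (id)
open import Relation.Binary using (Decidable)
open import Relation.Binary.PropositionalEquality as ≡ using (_≡_; _≢_)
open import Relation.Nullary using (yes; no)
open import Algebra.Bundles using (CommutativeRing)
import Data.Integer as ℤ
import Data.Integer.Properties as ℤP
import Data.Rational as ℚ
import Data.Rational.Properties as ℚP

-- The argument works over any commutative ring R with decidable equality in
-- which (i) √2 does not exist (d² = 2a² ⇒ d = 0) and (ii) a vanishing sum of
-- three squares has vanishing terms; this is the module RankArgument.
--   * rank N₂ = 1 makes every minor of N₂ vanish, i.e. x₁ = x₂ = x₃ =: a;
--     then pᵢ = 2a² − dᵢ².
--   * If all pᵢ = 0 then dᵢ² = 2a², so by (i) every dᵢ = 0 — but then every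
--     minor of N₁ vanishes, contradicting rank N₁ = 2.
--   * The factor equations reduce to that case: with qᵢ = 2a² − dᵢ² one has
--     Σ pᵢ² = 2a²·p̃₂ − p̃₇ = 0, so by (ii) every pᵢ = 0.
-- Properties (i) and (ii) are then proved for ℕ (by infinite descent and
-- positivity), transported to ℤ via absolute values, and to ℚ via ordering
-- and clearing of denominators; the theorem instantiates RankArgument twice.

module RankArgument {c ℓ : Level} (R : CommutativeRing c ℓ)
                    (_≟_ : Decidable (CommutativeRing._≈_ R)) where
  open CommutativeRing R hiding (zero)
  open import Data.Fin using (Fin; zero; suc)
  open Generic R _≟_
  open import Algebra.Properties.Ring ring
    using (x∙y⁻¹≈ε⇒x≈y; x≈y⇒x∙y⁻¹≈ε; -‿+-comm; [y-z]x≈yx-zx)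
  open import Algebra.Properties.CommutativeSemigroup +-commutativeSemigroup
    using (interchange)
  open import Relation.Binary.Reasoning.Setoid setoid

  NoSqrtTwo : Set (c ⊔ ℓ)
  NoSqrtTwo = ∀ a d → d * d ≈ a * a + a * a → d ≈ 0#

  SumOfSquaresVanishes : Set (c ⊔ ℓ)
  SumOfSquaresVanishes = ∀ u v w → u * u + v * v + w * w ≈ 0# → (u ≈ 0#) × (v ≈ 0#) × (w ≈ 0#)

  nz-false⇒≈0 : ∀ a → nz a ≡ false → a ≈ 0#
  nz-false⇒≈0 a h with a ≟ 0#
  ... | yes a≈0 = a≈0
  nz-false⇒≈0 a () | no _

  ≈0⇒nz-false : ∀ a → a ≈ 0# → nz a ≡ false
  ≈0⇒nz-false a a≈0 with a ≟ 0#
  ... | yes _   = ≡.refl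
  ... | no a≉0 = ⊥-elim (a≉0 a≈0)

  rank-formula≡1 : ∀ b₁ b₂ b₃ e → (if b₁ ∨ b₂ ∨ b₃ then 2 else (if e then 1 else 0)) ≡ 1
                 → (b₁ ≡ false) × (b₂ ≡ false)
  rank-formula≡1 false false false _ _ = ≡.refl , ≡.refl
  rank-formula≡1 false false true  _ ()
  rank-formula≡1 false true  _     _ ()
  rank-formula≡1 true  _     _     _ ()

  rank-formula≢2 : ∀ b₁ b₂ b₃ e → b₁ ≡ false → b₂ ≡ false → b₃ ≡ false
                 → (if b₁ ∨ b₂ ∨ b₃ then 2 else (if e then 1 else 0)) ≢ 2
  rank-formula≢2 false false false true  ≡.refl ≡.refl ≡.refl ()
  rank-formula≢2 false false false false ≡.refl ≡.refl ≡.refl ()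

  rank≡1⇒minors≈0 : ∀ M → rank M ≡ 1 → (minor M i0 i1 ≈ 0#) × (minor M i0 i2 ≈ 0#)
  rank≡1⇒minors≈0 M h =
    let m₀₁ , m₀₂ = rank-formula≡1 (nz (minor M i0 i1)) (nz (minor M i0 i2))
                                   (nz (minor M i1 i2)) (someEntryNZ M) h
    in nz-false⇒≈0 _ m₀₁ , nz-false⇒≈0 _ m₀₂

  minors≈0⇒rank≢2 : ∀ M → minor M i0 i1 ≈ 0# → minor M i0 i2 ≈ 0# → minor M i1 i2 ≈ 0#
                  → rank M ≢ 2
  minors≈0⇒rank≢2 M m₀₁ m₀₂ m₁₂ =
    rank-formula≢2 _ _ _ (someEntryNZ M)
      (≈0⇒nz-false _ m₀₁) (≈0⇒nz-false _ m₀₂) (≈0⇒nz-false _ m₁₂)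

  -- A matrix with rows (1, vᵢ), such as N₁ and N₂, has minor 1·vⱼ − 1·vᵢ on
  -- rows i, j; it vanishes exactly when vᵢ ≈ vⱼ.
  unit-minor≈0⇒≈ : ∀ u w → 1# * w - 1# * u ≈ 0# → w ≈ u
  unit-minor≈0⇒≈ u w h = begin
    w       ≈⟨ *-identityˡ w ⟨
    1# * w  ≈⟨ x∙y⁻¹≈ε⇒x≈y _ _ h ⟩
    1# * u  ≈⟨ *-identityˡ u ⟩
    u       ∎

  ≈⇒unit-minor≈0 : ∀ u w → w ≈ u → 1# * w - 1# * u ≈ 0#
  ≈⇒unit-minor≈0 u w w≈u = x≈y⇒x∙y⁻¹≈ε (*-congˡ w≈u)

  rank-one⇒constant : ∀ x → rank (N₂ x) ≡ 1 → (x i1 ≈ x i0) × (x i2 ≈ x i0)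
  rank-one⇒constant x h =
    let m₀₁ , m₀₂ = rank≡1⇒minors≈0 (N₂ x) h
    in unit-minor≈0⇒≈ (x i0) (x i1) m₀₁ , unit-minor≈0⇒≈ (x i0) (x i2) m₀₂

  rank-two⇒nonzero : ∀ d → rank (N₁ d) ≡ 2 → d i0 ≈ 0# → d i1 ≈ 0# → d i2 ≈ 0# → ⊥
  rank-two⇒nonzero d h d₀≈0 d₁≈0 d₂≈0 =
    minors≈0⇒rank≢2 (N₁ d)
      (≈⇒unit-minor≈0 _ _ (trans d₁≈0 (sym d₀≈0)))
      (≈⇒unit-minor≈0 _ _ (trans d₂≈0 (sym d₀≈0)))
      (≈⇒unit-minor≈0 _ _ (trans d₂≈0 (sym d₁≈0)))
      h

  p-at-constant : ∀ x d → x i1 ≈ x i0 → x i2 ≈ x i0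
                → ∀ i → p x d i ≈ sq (x i0) + sq (x i0) - sq (d i)
  p-at-constant x d x₁≈x₀ x₂≈x₀ zero =
    +-congʳ (+-cong (*-cong x₁≈x₀ x₁≈x₀) (*-cong x₂≈x₀ x₂≈x₀))
  p-at-constant x d x₁≈x₀ x₂≈x₀ (suc zero) =
    +-congʳ (+-congʳ (*-cong x₂≈x₀ x₂≈x₀))
  p-at-constant x d x₁≈x₀ x₂≈x₀ (suc (suc zero)) =
    +-congʳ (+-congˡ (*-cong x₁≈x₀ x₁≈x₀))

  Σ₃-cong : ∀ f g → (∀ i → f i ≈ g i) → Σ₃ f ≈ Σ₃ g
  Σ₃-cong f g f≈g = +-cong (+-cong (f≈g i0) (f≈g i1)) (f≈g i2)

  -‿interchange : ∀ a b a′ b′ → (a - b) + (a′ - b′) ≈ (a + a′) - (b + b′)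
  -‿interchange a b a′ b′ = trans (interchange a (- b) a′ (- b′)) (+-congˡ (-‿+-comm b b′))

  Σ₃-distrib-- : ∀ f g → Σ₃ (λ i → f i - g i) ≈ Σ₃ f - Σ₃ g
  Σ₃-distrib-- f g = begin
    (f i0 - g i0) + (f i1 - g i1) + (f i2 - g i2)
      ≈⟨ +-congʳ (-‿interchange (f i0) (g i0) (f i1) (g i1)) ⟩
    (f i0 + f i1 - (g i0 + g i1)) + (f i2 - g i2)
      ≈⟨ -‿interchange (f i0 + f i1) (g i0 + g i1) (f i2) (g i2) ⟩
    Σ₃ f - Σ₃ g ∎

  Σ₃-scale : ∀ s f → Σ₃ (λ i → s * f i) ≈ s * Σ₃ f
  Σ₃-scale s f = begin
    s * f i0 + s * f i1 + s * f i2  ≈⟨ +-congʳ (distribˡ s (f i0) (f i1)) ⟨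
    s * (f i0 + f i1) + s * f i2    ≈⟨ distribˡ s (f i0 + f i1) (f i2) ⟨
    s * Σ₃ f                        ∎

  -- The key identity: for qᵢ = s − eᵢ one has qᵢ² = s·qᵢ − eᵢ·qᵢ, hence
  -- Σ qᵢ² = s·Σ qᵢ − Σ eᵢqᵢ.  With s = 2a², eᵢ = dᵢ² this reads Σ pᵢ² = 2a²·p̃₂ − p̃₇.
  sum-of-squares-identity : ∀ s (e : Fin 3 → Carrier) →
    Σ₃ (λ i → (s - e i) * (s - e i)) ≈ s * Σ₃ (λ i → s - e i) - Σ₃ (λ i → e i * (s - e i))
  sum-of-squares-identity s e = begin
    Σ₃ (λ i → q i * q i)                       ≈⟨ Σ₃-cong _ _ (λ i → [y-z]x≈yx-zx (q i) s (e i)) ⟩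
    Σ₃ (λ i → s * q i - e i * q i)             ≈⟨ Σ₃-distrib-- (λ i → s * q i) (λ i → e i * q i) ⟩
    Σ₃ (λ i → s * q i) - Σ₃ (λ i → e i * q i)  ≈⟨ +-congʳ (Σ₃-scale s q) ⟩
    s * Σ₃ q - Σ₃ (λ i → e i * q i)            ∎
    where
    q : Fin 3 → Carrier
    q i = s - e i

  vanishing-p⇒d≈0 : NoSqrtTwo → ∀ x d → x i1 ≈ x i0 → x i2 ≈ x i0
                  → ∀ i → p x d i ≈ 0# → d i ≈ 0#
  vanishing-p⇒d≈0 no√2 x d x₁≈x₀ x₂≈x₀ i pᵢ≈0 =
    no√2 (x i0) (d i) (sym (x∙y⁻¹≈ε⇒x≈y _ _ (trans (sym (p-at-constant x d x₁≈x₀ x₂≈x₀ i)) pᵢ≈0)))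

  -- For constant x, the factor equations p̃₂ = p̃₇ = 0 give Σ pᵢ² = 2a²·p̃₂ − p̃₇ = 0,
  -- so every pᵢ vanishes.
  factor-eqs⇒p-eqs : SumOfSquaresVanishes → ∀ x d → x i1 ≈ x i0 → x i2 ≈ x i0
                   → p̃₂ x d ≈ 0# → p̃₇ x d ≈ 0# → PEqs x d
  factor-eqs⇒p-eqs sos x d x₁≈x₀ x₂≈x₀ p̃₂≈0 p̃₇≈0 =
    let q₀≈0 , q₁≈0 , q₂≈0 = sos (q i0) (q i1) (q i2) Σq²≈0
    in trans (p≈q i0) q₀≈0 , trans (p≈q i1) q₁≈0 , trans (p≈q i2) q₂≈0
    where
    s : Carrier
    s = sq (x i0) + sq (x i0)
    e q : Fin 3 → Carrier
    e i = sq (d i)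
    q i = s - e i
    p≈q : ∀ i → p x d i ≈ q i
    p≈q = p-at-constant x d x₁≈x₀ x₂≈x₀
    Σq≈0 : Σ₃ q ≈ 0#
    Σq≈0 = trans (sym (Σ₃-cong _ _ p≈q)) p̃₂≈0
    Σeq≈0 : Σ₃ (λ i → e i * q i) ≈ 0#
    Σeq≈0 = trans (sym (Σ₃-cong _ _ (λ i → *-congˡ {e i} (p≈q i)))) p̃₇≈0
    Σq²≈0 : Σ₃ (λ i → q i * q i) ≈ 0#
    Σq²≈0 = trans (sum-of-squares-identity s e)
                  (x≈y⇒x∙y⁻¹≈ε (trans (*-congˡ Σq≈0) (trans (zeroʳ s) (sym Σeq≈0))))

  no-solution-of-p-eqs : NoSqrtTwo → NoSolution PEqs
  no-solution-of-p-eqs no√2 (x , d , _ , rank₁ , rank₂ , p₀≈0 , p₁≈0 , p₂≈0) =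
    let x₁≈x₀ , x₂≈x₀ = rank-one⇒constant x rank₂
        d≈0 = vanishing-p⇒d≈0 no√2 x d x₁≈x₀ x₂≈x₀
    in rank-two⇒nonzero d rank₁ (d≈0 i0 p₀≈0) (d≈0 i1 p₁≈0) (d≈0 i2 p₂≈0)

  no-solution-of-factor-eqs : SumOfSquaresVanishes → NoSqrtTwo → NoSolution FactorEqs
  no-solution-of-factor-eqs sos no√2 (x , d , L , rank₁ , rank₂ , p̃₂≈0 , _ , _ , _ , _ , p̃₇≈0 , _) =
    let x₁≈x₀ , x₂≈x₀ = rank-one⇒constant x rank₂
    in no-solution-of-p-eqs no√2
         (x , d , L , rank₁ , rank₂ , factor-eqs⇒p-eqs sos x d x₁≈x₀ x₂≈x₀ p̃₂≈0 p̃₇≈0)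

module Naturals where
  open ≡ using (refl; sym; trans; cong₂)
  open import Data.Nat
  open import Data.Nat.Properties
  open import Data.Nat.Divisibility using (divides)
  open import Data.Nat.Primality using (prime[2]; euclidsLemma)
  open import Data.Nat.Induction using (<-wellFounded)
  open import Data.Nat.Tactic.RingSolver using (solve-∀)
  open import Induction.InfiniteDescent using (Descent; descent∧wf⇒empty)

  square≡0 : ∀ m → m * m ≡ 0 → m ≡ 0
  square≡0 m h = [ id , id ]′ (m*n≡0⇒m≡0∨n≡0 m h)

  sum-of-squares≡0 : ∀ m n k → m * m + n * n + k * k ≡ 0 → (m ≡ 0) × (n ≡ 0) × (k ≡ 0)
  sum-of-squares≡0 m n k h =
    square≡0 m (m+n≡0⇒m≡0 (m * m) m²+n²≡0) ,
    square≡0 n (m+n≡0⇒n≡0 (m * m) m²+n²≡0) ,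
    square≡0 k (m+n≡0⇒n≡0 (m * m + n * n) h)
    where
    m²+n²≡0 : m * m + n * n ≡ 0
    m²+n²≡0 = m+n≡0⇒m≡0 (m * m + n * n) h

  double≡*2 : ∀ x → x + x ≡ x * 2
  double≡*2 = solve-∀

  double-injective : ∀ x y → x + x ≡ y + y → x ≡ y
  double-injective x y h = *-cancelʳ-≡ x y 2 (trans (sym (double≡*2 x)) (trans h (double≡*2 y)))

  square-even⇒even : ∀ n m → n * n ≡ m * m + m * m → ∃[ k ] n ≡ k + k
  square-even⇒even n m h =
    let divides k n≡k*2 = [ id , id ]′ (euclidsLemma n n prime[2]
                                          (divides (m * m) (trans h (double≡*2 (m * m)))))
    in k , trans n≡k*2 (sym (double≡*2 k))

  square-of-double : ∀ k → (k + k) * (k + k) ≡ (k * k + k * k) + (k * k + k * k)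
  square-of-double = solve-∀

  halve : ∀ n m → n * n ≡ m * m + m * m → ∃[ k ] (n ≡ k + k) × (m * m ≡ k * k + k * k)
  halve n m h =
    let k , n≡k+k = square-even⇒even n m h
    in k , n≡k+k , double-injective (m * m) (k * k + k * k)
                     (trans (sym h) (trans (cong₂ _*_ n≡k+k n≡k+k) (square-of-double k)))

  PositiveSolution : ℕ → Set
  PositiveSolution n = 0 < n × ∃[ m ] n * n ≡ m * m + m * m

  half-of-positive : ∀ {n} k → n ≡ k + k → 0 < n → (0 < k) × (k < n)
  half-of-positive zero    refl ()
  half-of-positive (suc k) refl _ = s≤s z≤n , m<m+n (suc k) (s≤s z≤n)

  -- Infinite descent: halving twice turns a positive solution (n, m) with
  -- n = 2k, m = 2j into the smaller positive solution (k, j).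
  smaller-solution : Descent _<_ PositiveSolution
  smaller-solution {n} (0<n , m , n²≡2m²) =
    let k , n≡k+k , m²≡2k² = halve n m n²≡2m²
        j , _ , k²≡2j² = halve m k m²≡2k²
        0<k , k<n = half-of-positive k n≡k+k 0<n
    in k , k<n , 0<k , j , k²≡2j²

  no-sqrt-two : ∀ n m → n * n ≡ m * m + m * m → n ≡ 0
  no-sqrt-two zero    m h = refl
  no-sqrt-two (suc n) m h =
    ⊥-elim (descent∧wf⇒empty smaller-solution <-wellFounded (suc n) (s≤s z≤n , m , h))

module Integers where
  open ≡ using (refl; sym; trans; cong₂)
  open import Data.Nat as ℕ using (ℕ)
  open import Data.Integer
  open import Data.Integer.Properties using (pos-*; +-injective; ∣i∣≡0⇒i≡0)

  square≡+∣∣² : ∀ i → i * i ≡ + (∣ i ∣ ℕ.* ∣ i ∣)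
  square≡+∣∣² (+ n)    = sym (pos-* n n)
  square≡+∣∣² -[1+ n ] = refl

  -- Both ring properties transfer from ℕ, since squares in ℤ are squares in ℕ.
  sum-of-squares≡0 : ∀ a b c → a * a + b * b + c * c ≡ 0ℤ → (a ≡ 0ℤ) × (b ≡ 0ℤ) × (c ≡ 0ℤ)
  sum-of-squares≡0 a b c h =
    let ∣a∣≡0 , ∣b∣≡0 , ∣c∣≡0 = Naturals.sum-of-squares≡0 (∣ a ∣) (∣ b ∣) (∣ c ∣) (+-injective
          (trans (sym (cong₂ _+_ (cong₂ _+_ (square≡+∣∣² a) (square≡+∣∣² b)) (square≡+∣∣² c))) h))
    in ∣i∣≡0⇒i≡0 ∣a∣≡0 , ∣i∣≡0⇒i≡0 ∣b∣≡0 , ∣i∣≡0⇒i≡0 ∣c∣≡0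

  no-sqrt-two : ∀ a d → d * d ≡ a * a + a * a → d ≡ 0ℤ
  no-sqrt-two a d h = ∣i∣≡0⇒i≡0 (Naturals.no-sqrt-two (∣ d ∣) (∣ a ∣) (+-injective
    (trans (sym (square≡+∣∣² d)) (trans h (cong₂ _+_ (square≡+∣∣² a) (square≡+∣∣² a))))))

module Rationals where
  open ≡ using (refl; sym; trans; cong; cong₂; subst₂; module ≡-Reasoning)
  open import Data.Nat as ℕ using (ℕ)
  open ℤ using (+_; 0ℤ)
  open import Data.Integer.Tactic.RingSolver using (solve-∀)
  open import Data.Rational
  open import Data.Rational.Properties
  open import Data.Sum using (inj₁; inj₂)
  import Data.Rational.Unnormalised.Properties as ℚᵘ

  square-nonneg : ∀ p → 0ℚ ≤ p * p
  square-nonneg p with ≤-total 0ℚ p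
  ... | inj₁ 0≤p = let instance _ = nonNegative 0≤p in nonNegative⁻¹ (p * p) {{nonNeg*nonNeg⇒nonNeg p p}}
  ... | inj₂ p≤0 = let instance _ = nonPositive p≤0 in nonNegative⁻¹ (p * p) {{nonPos*nonPos⇒nonPos p p}}

  square≡0 : ∀ p → p * p ≡ 0ℚ → p ≡ 0ℚ
  square≡0 p h = ↥p≡0⇒p≡0 p ([ id , id ]′ (ℤP.i*j≡0⇒i≡0∨j≡0 (↥ p) ↥p²≡0))
    where
    ↥p²≡0 : ↥ p ℤ.* ↥ p ≡ 0ℤ
    ↥p²≡0 rewrite sym (↥-* p p) | p≡0⇒↥p≡0 (p * p) h = refl

  nonneg-sum≡0 : ∀ u v → 0ℚ ≤ u → 0ℚ ≤ v → u + v ≡ 0ℚ → (u ≡ 0ℚ) × (v ≡ 0ℚ)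
  nonneg-sum≡0 u v 0≤u 0≤v h = left u v 0≤u 0≤v h , left v u 0≤v 0≤u (trans (+-comm v u) h)
    where
    left : ∀ u v → 0ℚ ≤ u → 0ℚ ≤ v → u + v ≡ 0ℚ → u ≡ 0ℚ
    left u v 0≤u 0≤v h = ≤-antisym (subst₂ _≤_ (+-identityʳ u) h (+-monoʳ-≤ u 0≤v)) 0≤u

  sum-of-squares≡0 : ∀ a b c → a * a + b * b + c * c ≡ 0ℚ → (a ≡ 0ℚ) × (b ≡ 0ℚ) × (c ≡ 0ℚ)
  sum-of-squares≡0 a b c h =
    let a²+b²≡0 , c²≡0 = nonneg-sum≡0 _ _ (+-mono-≤ (square-nonneg a) (square-nonneg b)) (square-nonneg c) h
        a²≡0 , b²≡0 = nonneg-sum≡0 _ _ (square-nonneg a) (square-nonneg b) a²+b²≡0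
    in square≡0 a a²≡0 , square≡0 b b²≡0 , square≡0 c c²≡0

  -- Clearing denominators: with α/A and δ/D in lowest terms, the cross-multiplied
  -- form of δ²/D² = 2α²/A² becomes (δAA)² = 2(αDA)² in ℤ.
  clear-denominators : ∀ α δ (A D : ℕ) →
    (δ ℤ.* δ) ℤ.* + ((A ℕ.* A) ℕ.* (A ℕ.* A))
      ≡ ((α ℤ.* α) ℤ.* + (A ℕ.* A) ℤ.+ (α ℤ.* α) ℤ.* + (A ℕ.* A)) ℤ.* + (D ℕ.* D) →
    (δ ℤ.* + A ℤ.* + A) ℤ.* (δ ℤ.* + A ℤ.* + A)
      ≡ (α ℤ.* + D ℤ.* + A) ℤ.* (α ℤ.* + D ℤ.* + A) ℤ.+ (α ℤ.* + D ℤ.* + A) ℤ.* (α ℤ.* + D ℤ.* + A)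
  clear-denominators α δ A D h = begin
    (δ ℤ.* + A ℤ.* + A) ℤ.* (δ ℤ.* + A ℤ.* + A)
      ≡⟨ regroupˡ δ (+ A) ⟩
    (δ ℤ.* δ) ℤ.* ((+ A ℤ.* + A) ℤ.* (+ A ℤ.* + A))
      ≡⟨ cong ((δ ℤ.* δ) ℤ.*_) (trans (ℤP.pos-* (A ℕ.* A) (A ℕ.* A)) (cong₂ ℤ._*_ (ℤP.pos-* A A) (ℤP.pos-* A A))) ⟨
    (δ ℤ.* δ) ℤ.* + ((A ℕ.* A) ℕ.* (A ℕ.* A))
      ≡⟨ h ⟩
    ((α ℤ.* α) ℤ.* + (A ℕ.* A) ℤ.+ (α ℤ.* α) ℤ.* + (A ℕ.* A)) ℤ.* + (D ℕ.* D)
      ≡⟨ cong₂ (λ A² D² → ((α ℤ.* α) ℤ.* A² ℤ.+ (α ℤ.* α) ℤ.* A²) ℤ.* D²) (ℤP.pos-* A A) (ℤP.pos-* D D) ⟩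
    ((α ℤ.* α) ℤ.* (+ A ℤ.* + A) ℤ.+ (α ℤ.* α) ℤ.* (+ A ℤ.* + A)) ℤ.* (+ D ℤ.* + D)
      ≡⟨ regroupʳ α (+ A) (+ D) ⟩
    (α ℤ.* + D ℤ.* + A) ℤ.* (α ℤ.* + D ℤ.* + A) ℤ.+ (α ℤ.* + D ℤ.* + A) ℤ.* (α ℤ.* + D ℤ.* + A) ∎
    where
    open ≡-Reasoning
    regroupˡ : ∀ δ a → (δ ℤ.* a ℤ.* a) ℤ.* (δ ℤ.* a ℤ.* a) ≡ (δ ℤ.* δ) ℤ.* ((a ℤ.* a) ℤ.* (a ℤ.* a))
    regroupˡ = solve-∀
    regroupʳ : ∀ α a d → ((α ℤ.* α) ℤ.* (a ℤ.* a) ℤ.+ (α ℤ.* α) ℤ.* (a ℤ.* a)) ℤ.* (d ℤ.* d)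
             ≡ (α ℤ.* d ℤ.* a) ℤ.* (α ℤ.* d ℤ.* a) ℤ.+ (α ℤ.* d ℤ.* a) ℤ.* (α ℤ.* d ℤ.* a)
    regroupʳ = solve-∀

  cancel-denominator : ∀ i n → i ℤ.* + ℕ.suc n ≡ 0ℤ → i ≡ 0ℤ
  cancel-denominator i n = ℤP.*-cancelʳ-≡ i 0ℤ (+ ℕ.suc n)

  no-sqrt-two : ∀ a d → d * d ≡ a * a + a * a → d ≡ 0ℚ
  no-sqrt-two a@(mkℚ α a-1 _) d@(mkℚ δ d-1 _) h =
    ↥p≡0⇒p≡0 d (cancel-denominator δ a-1 (cancel-denominator (δ ℤ.* + A) a-1
      (Integers.no-sqrt-two (α ℤ.* + D ℤ.* + A) (δ ℤ.* + A ℤ.* + A)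
        (clear-denominators α δ A D cross-multiplied))))
    where
    A D : ℕ
    A = ℕ.suc a-1
    D = ℕ.suc d-1
    -- d² = 2a² read through the unnormalised rationals, whose operations do not reduce fractions
    cross-multiplied : (δ ℤ.* δ) ℤ.* + ((A ℕ.* A) ℕ.* (A ℕ.* A))
      ≡ ((α ℤ.* α) ℤ.* + (A ℕ.* A) ℤ.+ (α ℤ.* α) ℤ.* + (A ℕ.* A)) ℤ.* + (D ℕ.* D)
    cross-multiplied = ℚᵘ.drop-*≡* (ℚᵘ.≃-trans (ℚᵘ.≃-sym (toℚᵘ-homo-* d d))
      (ℚᵘ.≃-trans (toℚᵘ-cong h)
      (ℚᵘ.≃-trans (toℚᵘ-homo-+ (a * a) (a * a)) (ℚᵘ.+-cong (toℚᵘ-homo-* a a) (toℚᵘ-homo-* a a)))))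

module ℤ-argument = RankArgument ℤP.+-*-commutativeRing ℤ._≟_
module ℚ-argument = RankArgument ℚP.+-*-commutativeRing ℚ._≟_

theorem4p1 : (Zc.NoSolution Zc.FactorEqs × Qc.NoSolution Qc.FactorEqs)
           × (Zc.NoSolution Zc.PEqs × Qc.NoSolution Qc.PEqs)
theorem4p1 =
  ( ℤ-argument.no-solution-of-factor-eqs Integers.sum-of-squares≡0 Integers.no-sqrt-two
  , ℚ-argument.no-solution-of-factor-eqs Rationals.sum-of-squares≡0 Rationals.no-sqrt-two )
  , ( ℤ-argument.no-solution-of-p-eqs Integers.no-sqrt-two
    , ℚ-argument.no-solution-of-p-eqs Rationals.no-sqrt-two )
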